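{- Let $\Gamma=(P,L,I)$ be a rank $2$ incidence geometry and let $\lambda,k_1,k_2,l\in\mathbb{N}$ satisfy $k_1+k_2-\lambda\geq l$. Consider the pebble game on $\Gamma$ with these parameters. Then at every point of the game (that is, after any finite sequence of legal moves $\textbf{Accept-Edge}$ and $\textbf{Move-Pebble}$ starting from the initial configuration) the following hold: \begin{enumerate} \item For every vertex $v\in P\cup L$, $\mathrm{peb}(v)+\mathrm{out}(v)=k_{\tau(v)}$. \item For all subsets $A\subseteq P$ and $B\subseteq L$, with $V=A\cup B$: $\mathrm{peb}(V)+\mathrm{span}(V)+\mathrm{out}(V)=k_1|A|+k_2|B|$. \item For all nonempty subsets $A\subseteq P$ and $B\subseteq L$, with $V=A\cup B$: $\mathrm{peb}(V)+\mathrm{out}(V)\geq l$. \item For all nonempty subsets $A\subseteq P$ and $B\subseteq L$, with $V=A\cup B$: $\mathrm{span}(V)\leq k_1|A|+k_2|B|-l$. \end{enumerate}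
   Context: A rank $2$ incidence geometry is a triple $\Gamma=(P,L,I)$ with $P$ (points) and $L$ (lines) finite disjoint sets and $I\subseteq P\times L$ (incidences). Pebble game. Let $I_\lambda(\Gamma)$ be the multigraph with vertex set $P\cup L$ and edge set $\{(p,\ell,i): (p,\ell)\in I,\ i\in\{1,\dots,\lambda\}\}$, the edge $(p,\ell,i)$ having endpoints $p$ and $\ell$ (the $\lambda$ edges $(p,\ell,i)$ are said to be associated to the incidence $(p,\ell)$). Set $\tau(v)=1$ if $v\in P$ and $\tau(v)=2$ if $v\in L$. The game maintains a directed multigraph $D$ on vertex set $P\cup L$ whose edges (the accepted edges) form a subset of the edges of $I_\lambda(\Gamma)$, each given an orientation, together with a number of pebbles $\mathrm{peb}(v)\in\mathbb{N}$ at each vertex $v$. Initially $D$ has no edges and $\mathrm{peb}(v)=k_{\tau(v)}$ for all $v$. The legal moves are: - $\textbf{Accept-Edge}(e)$: if $e=(v,w,i)$ is an edge of $I_\lambda(\Gamma)$ not in $D$ and $\mathrm{peb}(v)+\mathrm{peb}(w)>l$, remove a pebble from one endpoint $x\in\{v,w\}$ (with $\mathrm{peb}(x)>0$) and add $e$ to $D$ oriented from $x$ to the other endpoint. - $\textbf{Move-Pebble}(v\leftarrow w)$: if there is a directed path in $D$ from $v$ to $w$ and $\mathrm{peb}(w)>0$, add a pebble to $v$, remove a pebble from $w$, and reverse the orientation of every edge of that path. For $V\subseteq P\cup L$: $\mathrm{peb}(V)=\sum_{v\in V}\mathrm{peb}(v)$; $\mathrm{span}(V)$ is the number of edges $e$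 of $D$ whose source and target both lie in $V$; $\mathrm{out}(V)$ is the number of edges of $D$ with source in $V$ and target not in $V$; $\mathrm{out}(v)=\mathrm{out}(\{v\})$. -}

module Defs where

open import Data.Nat using (ℕ; zero; suc; _+_; _∸_; _<_)
open import Data.Fin using (Fin; zero; suc)
import Data.Fin as Fin
open import Data.Fin.Subset using (Subset; _∈_; _∉_)
open import Data.Fin.Subset.Properties using (_∈?_)
open import Data.Bool using (Bool; true; false; if_then_else_; _∧_; not; _∨_)
open import Data.Maybe using (Maybe; just; nothing)
import Data.Maybe as Maybe
open import Data.Sum using (_⊎_; inj₁; inj₂)
import Data.Sum.Properties as SumP
import Data.Product.Properties as ProdP
open import Data.Product using (_×_; _,_)
open import Data.List using (List; []; _∷_; [_])
open import Data.List.Relation.Unary.Unique.Propositional using (Unique)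
open import Relation.Binary.PropositionalEquality using (_≡_)
open import Relation.Binary.Definitions using (DecidableEquality)
open import Relation.Nullary.Decidable using (⌊_⌋)

sumFin : (n : ℕ) → (Fin n → ℕ) → ℕ
sumFin zero    f = 0
sumFin (suc n) f = f zero + sumFin n (λ i → f (suc i))

data Dir : Set where
  P→L L→P : Dir

flipDir : Dir → Dir
flipDir P→L = L→P
flipDir L→P = P→L

-- The pebble game on Γ = (P, L, I) with P = Fin np, L = Fin nl, incidence I,
-- multiplicity lam (= λ) and parameters k₁ k₂ l.
module Game (np nl lam k₁ k₂ l : ℕ) (I : Fin np → Fin nl → Bool) where

  Vertex : Set
  Vertex = Fin np ⊎ Fin nl

  _≟V_ : DecidableEquality Vertex
  _≟V_ = SumP.≡-dec Fin._≟_ Fin._≟_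

  kτ : Vertex → ℕ
  kτ (inj₁ _) = k₁
  kτ (inj₂ _) = k₂

  -- candidate edges (p, ℓ, i) of I_λ(Γ); a genuine edge needs I p ℓ ≡ true
  EKey : Set
  EKey = Fin np × Fin nl × Fin lam

  _≟E_ : DecidableEquality EKey
  _≟E_ = ProdP.≡-dec Fin._≟_ (ProdP.≡-dec Fin._≟_ Fin._≟_)

  src tgt : EKey → Dir → Vertex
  src (p , ℓ , i) P→L = inj₁ p
  src (p , ℓ , i) L→P = inj₂ ℓ
  tgt (p , ℓ , i) P→L = inj₂ ℓ
  tgt (p , ℓ , i) L→P = inj₁ p

  -- a game state: the directed multigraph D (nothing = edge not in D,
  -- just d = accepted with orientation d) and the pebble counts
  record State : Set where
    constructor mkState
    field
      peb : Vertex → ℕ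
      D   : EKey → Maybe Dir
  open State public

  initial : State
  initial = mkState kτ (λ _ → nothing)

  decr incr : Vertex → (Vertex → ℕ) → (Vertex → ℕ)
  decr w f x = if ⌊ x ≟V w ⌋ then f x ∸ 1 else f x
  incr v f x = if ⌊ x ≟V v ⌋ then suc (f x) else f x

  setE : EKey → Maybe Dir → (EKey → Maybe Dir) → (EKey → Maybe Dir)
  setE e m D e' = if ⌊ e' ≟E e ⌋ then m else D e'

  memb : EKey → List EKey → Bool
  memb e []        = false
  memb e (e' ∷ es) = ⌊ e ≟E e' ⌋ ∨ memb e es

  flipOn : List EKey → (EKey → Maybe Dir) → (EKey → Maybe Dir)
  flipOn es D e = if memb e es then Maybe.map flipDir (D e) else D e

  data Arc (D : EKey → Maybe Dir) : Vertex → Vertex → EKey → Set where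
    arc : ∀ e d → D e ≡ just d → Arc D (src e d) (tgt e d) e

  data Path (D : EKey → Maybe Dir) : Vertex → Vertex → List Vertex → List EKey → Set where
    here : ∀ {v} → Path D v v [ v ] []
    cons : ∀ {v u w vs es e} → Arc D v u e → Path D u w vs es → Path D v w (v ∷ vs) (e ∷ es)

  data Step : State → State → Set where
    accept-edge : ∀ {s} p ℓ i d →
      I p ℓ ≡ true →
      D s (p , ℓ , i) ≡ nothing →
      l < peb s (inj₁ p) + peb s (inj₂ ℓ) →
      0 < peb s (src (p , ℓ , i) d) →
      Step s (mkState (decr (src (p , ℓ , i) d) (peb s)) (setE (p , ℓ , i) (just d) (D s)))
    move-pebble : ∀ {s} v w vs es →
      Path (D s) v w vs es →
      Unique vs →
      0 < peb s w →
      Step s (mkState (incr v (decr w (peb s))) (flipOn es (D s)))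

  data Reachable : State → Set where
    init : Reachable initial
    step : ∀ {s s'} → Reachable s → Step s s' → Reachable s'

  countE : (EKey → Bool) → ℕ
  countE f = sumFin np (λ p → sumFin nl (λ ℓ → sumFin lam (λ i → if f (p , ℓ , i) then 1 else 0)))

  pebV : (Vertex → Bool) → State → ℕ
  pebV V s = sumFin np (λ p → if V (inj₁ p) then peb s (inj₁ p) else 0)
           + sumFin nl (λ ℓ → if V (inj₂ ℓ) then peb s (inj₂ ℓ) else 0)

  spanV : (Vertex → Bool) → State → ℕ
  spanV V s = countE (λ e → Maybe.maybe (λ d → V (src e d) ∧ V (tgt e d)) false (D s e))

  outV : (Vertex → Bool) → State → ℕ
  outV V s = countE (λ e → Maybe.maybe (λ d → V (src e d) ∧ not (V (tgt e d))) false (D s e))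

  single : Vertex → (Vertex → Bool)
  single v x = ⌊ x ≟V v ⌋

  union : Subset np → Subset nl → (Vertex → Bool)
  union A B (inj₁ p) = ⌊ p ∈? A ⌋
  union A B (inj₂ ℓ) = ⌊ ℓ ∈? B ⌋

-- Every pebble missing from a vertex sits on an accepted edge leaving it: Accept-Edge spends
-- a pebble at the source of the new edge, and Move-Pebble brings a pebble back to the start
-- of a path while reversing the path hands one unit of out-degree along it.  Hence for every
-- vertex set V the potential peb(V) + #{edges with source in V} stays at Σ_{v ∈ V} k_τ(v);
-- splitting those edges into the ones inside V and the ones leaving V gives (1) and (2).
-- For (3), peb(V) + out(V) is unchanged by Move-Pebble and drops only when an edge is
-- accepted with both ends in V, whose endpoints then held more than l pebbles; initially it
-- is at least k₁ + k₂ ≥ l.  Subtracting (3) from (2) gives (4).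
module Submission where

open import Defs
open import Data.Nat using (ℕ; zero; suc; _+_; _*_; _∸_; _≤_; _<_)
open import Data.Nat.Properties
open import Algebra.Properties.CommutativeSemigroup +-commutativeSemigroup
  using (interchange; xy∙z≈xz∙y; xy∙z≈x∙zy; x∙yz≈xz∙y; x∙yz≈y∙xz)
open import Data.Fin using (Fin; zero; suc)
import Data.Fin.Properties as Fin
open import Data.Fin.Subset using (Subset; ∣_∣; Nonempty; inside; outside)
open import Data.Fin.Subset.Properties using (_∈?_)
open import Data.Vec using ([]; _∷_)
open import Data.Bool using (Bool; true; false; if_then_else_; _∧_; not; _∨_)
open import Data.Bool.Properties using (∧-zeroʳ; ∧-comm; ¬-not)
open import Data.Maybe using (Maybe; just; nothing; maybe)
import Data.Maybe as Maybe
open import Data.Maybe.Properties using (just-injective)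
open import Data.Product using (_×_; _,_)
open import Data.Sum using (inj₁; inj₂)
open import Data.Sum.Properties using (inj₁-injective; inj₂-injective)
open import Data.List using (_∷_)
open import Data.List.Membership.Propositional using (_∈_)
open import Data.List.Relation.Unary.Any using (here; there)
open import Data.List.Relation.Unary.All using (lookup)
open import Data.List.Relation.Unary.AllPairs using (_∷_)
open import Data.List.Relation.Unary.Unique.Propositional using (Unique)
open import Function using (_∘_)
open import Relation.Binary.PropositionalEquality
open import Relation.Nullary using (¬_; Dec; yes; no)
open import Relation.Nullary.Decidable using (⌊_⌋; isYes≗does; dec-true; dec-false; ⌊⌋-map′)

ind : Bool → ℕ
ind b = if b then 1 else 0

isYes-true : {A : Set} (a? : Dec A) → A → ⌊ a? ⌋ ≡ true
isYes-true a? a = trans (isYes≗does a?) (dec-true a? a)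

isYes-false : {A : Set} (a? : Dec A) → ¬ A → ⌊ a? ⌋ ≡ false
isYes-false a? ¬a = trans (isYes≗does a?) (dec-false a? ¬a)

ind-split : ∀ x y → ind (x ∧ y) + ind (x ∧ not y) ≡ ind x
ind-split true  true  = refl
ind-split true  false = refl
ind-split false _     = refl

ind-leaving-swap : ∀ x y → ind (y ∧ not x) + ind x ≡ ind (x ∧ not y) + ind y
ind-leaving-swap true  true  = refl
ind-leaving-swap true  false = refl
ind-leaving-swap false true  = refl
ind-leaving-swap false false = refl

sumFin-cong : ∀ n {f g : Fin n → ℕ} → (∀ i → f i ≡ g i) → sumFin n f ≡ sumFin n g
sumFin-cong zero    f≗g = refl
sumFin-cong (suc n) f≗g = cong₂ _+_ (f≗g zero) (sumFin-cong n (λ i → f≗g (suc i)))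

sumFin-zero : ∀ n {f : Fin n → ℕ} → (∀ i → f i ≡ 0) → sumFin n f ≡ 0
sumFin-zero zero    f≗0 = refl
sumFin-zero (suc n) f≗0 = cong₂ _+_ (f≗0 zero) (sumFin-zero n (λ i → f≗0 (suc i)))

sumFin-distrib-+ : ∀ n (f g : Fin n → ℕ) →
  sumFin n (λ i → f i + g i) ≡ sumFin n f + sumFin n g
sumFin-distrib-+ zero    f g = refl
sumFin-distrib-+ (suc n) f g = begin
  f zero + g zero + sumFin n (λ i → f (suc i) + g (suc i))
    ≡⟨ cong (f zero + g zero +_) (sumFin-distrib-+ n (λ i → f (suc i)) (λ i → g (suc i))) ⟩
  f zero + g zero + (sumFin n (λ i → f (suc i)) + sumFin n (λ i → g (suc i)))
    ≡⟨ interchange (f zero) (g zero) _ _ ⟩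
  f zero + sumFin n (λ i → f (suc i)) + (g zero + sumFin n (λ i → g (suc i))) ∎
  where open ≡-Reasoning

term≤sumFin : ∀ n (f : Fin n → ℕ) i → f i ≤ sumFin n f
term≤sumFin (suc n) f zero    = m≤m+n (f zero) _
term≤sumFin (suc n) f (suc i) = ≤-trans (term≤sumFin n (λ j → f (suc j)) i) (m≤n+m _ (f zero))

sumFin-update : ∀ n {f g : Fin n → ℕ} j {a b} → (∀ i → i ≢ j → f i ≡ g i) →
  f j + a ≡ g j + b → sumFin n f + a ≡ sumFin n g + b
sumFin-update (suc n) {f} {g} zero off at =
  trans (xy∙z≈xz∙y (f zero) _ _)
    (trans (cong₂ _+_ at (sumFin-cong n (λ i → off (suc i) λ ())))
      (sym (xy∙z≈xz∙y (g zero) _ _)))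
sumFin-update (suc n) {f} {g} (suc j) off at =
  trans (+-assoc (f zero) _ _)
    (trans (cong₂ _+_ (off zero λ ()) (sumFin-update n j (λ i i≢j → off (suc i) (i≢j ∘ Fin.suc-injective)) at))
      (sym (+-assoc (g zero) _ _)))

sumFin-member : ∀ n (A : Subset n) k → sumFin n (λ i → if ⌊ i ∈? A ⌋ then k else 0) ≡ k * ∣ A ∣
sumFin-member zero    []      k = sym (*-zeroʳ k)
sumFin-member (suc n) (s ∷ A) k = head s (trans (sumFin-cong n tail) (sumFin-member n A k))
  where
  tail : ∀ i → (if ⌊ suc i ∈? s ∷ A ⌋ then k else 0) ≡ (if ⌊ i ∈? A ⌋ then k else 0)
  tail i = cong (λ b → if b then k else 0) (⌊⌋-map′ _ _ (i ∈? A))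
  head : ∀ s {t} → t ≡ k * ∣ A ∣ → (if ⌊ zero ∈? s ∷ A ⌋ then k else 0) + t ≡ k * ∣ s ∷ A ∣
  head inside  t≡k∣A∣ = trans (cong (k +_) t≡k∣A∣) (sym (*-suc k _))
  head outside t≡k∣A∣ = t≡k∣A∣

module GameInvariants (np nl lam k₁ k₂ l : ℕ) (I : Fin np → Fin nl → Bool) where
  open Game np nl lam k₁ k₂ l I

  sumV : (Vertex → ℕ) → ℕ
  sumV f = sumFin np (λ p → f (inj₁ p)) + sumFin nl (λ ℓ → f (inj₂ ℓ))

  restrict : (Vertex → Bool) → (Vertex → ℕ) → Vertex → ℕ
  restrict V f x = if V x then f x else 0

  weight : (Vertex → Bool) → ℕ
  weight V = sumV (restrict V kτ)

  sumV-update : ∀ {f g : Vertex → ℕ} x {a b} → (∀ y → y ≢ x → f y ≡ g y) →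
    f x + a ≡ g x + b → sumV f + a ≡ sumV g + b
  sumV-update {f} {g} (inj₁ p) off at =
    trans (xy∙z≈xz∙y (sumFin np (f ∘ inj₁)) _ _)
      (trans (cong₂ _+_ (sumFin-update np p (λ q q≢p → off (inj₁ q) (q≢p ∘ inj₁-injective)) at)
                        (sumFin-cong nl (λ ℓ → off (inj₂ ℓ) λ ())))
        (sym (xy∙z≈xz∙y (sumFin np (g ∘ inj₁)) _ _)))
  sumV-update {f} {g} (inj₂ ℓ) off at =
    trans (+-assoc (sumFin np (f ∘ inj₁)) _ _)
      (trans (cong₂ _+_ (sumFin-cong np (λ p → off (inj₁ p) λ ()))
                        (sumFin-update nl ℓ (λ m m≢ℓ → off (inj₂ m) (m≢ℓ ∘ inj₂-injective)) at))
        (sym (+-assoc (sumFin np (g ∘ inj₁)) _ _)))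

  sumV-supported : ∀ {f : Vertex → ℕ} v → (∀ y → y ≢ v → f y ≡ 0) → sumV f ≡ f v
  sumV-supported {f} v off = begin
    sumV f                ≡⟨ +-identityʳ _ ⟨
    sumV f + 0            ≡⟨ sumV-update v off (+-comm (f v) 0) ⟩
    sumV (λ _ → 0) + f v  ≡⟨ cong (_+ f v) (cong₂ _+_ (sumFin-zero np (λ _ → refl)) (sumFin-zero nl (λ _ → refl))) ⟩
    f v                   ∎
    where open ≡-Reasoning

  sumV-single : ∀ f v → sumV (restrict (single v) f) ≡ f v
  sumV-single f v =
    trans (sumV-supported v (λ y y≢v → cong (λ b → if b then f y else 0) (isYes-false (y ≟V v) y≢v)))
          (cong (λ b → if b then f v else 0) (isYes-true (v ≟V v) refl))

  pair≤sumV : ∀ V f {p ℓ} → V (inj₁ p) ≡ true → V (inj₂ ℓ) ≡ true →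
    f (inj₁ p) + f (inj₂ ℓ) ≤ sumV (restrict V f)
  pair≤sumV V f {p} {ℓ} p∈V ℓ∈V =
    +-mono-≤ (subst (_≤ _) (restricted p∈V) (term≤sumFin np (restrict V f ∘ inj₁) p))
             (subst (_≤ _) (restricted ℓ∈V) (term≤sumFin nl (restrict V f ∘ inj₂) ℓ))
    where
    restricted : ∀ {x} → V x ≡ true → restrict V f x ≡ f x
    restricted {x} x∈V = cong (λ b → if b then f x else 0) x∈V

  sumV-decr : ∀ V f w → 0 < f w → sumV (restrict V (decr w f)) + ind (V w) ≡ sumV (restrict V f)
  sumV-decr V f w 0<fw = trans (sumV-update w off at) (+-identityʳ _)
    where
    off : ∀ y → y ≢ w → restrict V (decr w f) y ≡ restrict V f y
    off y y≢w = cong (λ b → if V y then (if b then f y ∸ 1 else f y) else 0) (isYes-false (y ≟V w) y≢w)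
    at-w : ∀ b → (if b then f w ∸ 1 else 0) + ind b ≡ (if b then f w else 0) + 0
    at-w true  = trans (m∸n+n≡m 0<fw) (sym (+-identityʳ _))
    at-w false = refl
    at : restrict V (decr w f) w + ind (V w) ≡ restrict V f w + 0
    at = trans (cong (λ b → (if V w then (if b then f w ∸ 1 else f w) else 0) + ind (V w))
                     (isYes-true (w ≟V w) refl))
               (at-w (V w))

  sumV-incr : ∀ V f v → sumV (restrict V (incr v f)) ≡ sumV (restrict V f) + ind (V v)
  sumV-incr V f v = trans (sym (+-identityʳ _)) (sumV-update v off at)
    where
    off : ∀ y → y ≢ v → restrict V (incr v f) y ≡ restrict V f y
    off y y≢v = cong (λ b → if V y then (if b then suc (f y) else f y) else 0) (isYes-false (y ≟V v) y≢v)
    at-v : ∀ b → (if b then suc (f v) else 0) + 0 ≡ (if b then f v else 0) + ind b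
    at-v true  = trans (+-identityʳ _) (+-comm 1 (f v))
    at-v false = refl
    at : restrict V (incr v f) v + 0 ≡ restrict V f v + ind (V v)
    at = trans (cong (λ b → (if V v then (if b then suc (f v) else f v) else 0) + 0)
                     (isYes-true (v ≟V v) refl))
               (at-v (V v))

  arcHolds : (Vertex → Vertex → Bool) → EKey → Maybe Dir → Bool
  arcHolds h e = maybe (λ d → h (src e d) (tgt e d)) false

  edgeCount : (Vertex → Vertex → Bool) → (EKey → Maybe Dir) → ℕ
  edgeCount h D = countE (λ e → arcHolds h e (D e))

  countE-zero : ∀ {f : EKey → Bool} → (∀ e → f e ≡ false) → countE f ≡ 0
  countE-zero f≗false =
    sumFin-zero np (λ p → sumFin-zero nl (λ ℓ → sumFin-zero lam (λ i → cong ind (f≗false (p , ℓ , i)))))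

  countE-+ : ∀ {f g h : EKey → Bool} → (∀ e → ind (f e) + ind (g e) ≡ ind (h e)) →
    countE f + countE g ≡ countE h
  countE-+ {f} {g} pointwise =
    trans (sym (sumFin-distrib-+ np _ _)) (sumFin-cong np λ p →
    trans (sym (sumFin-distrib-+ nl _ _)) (sumFin-cong nl λ ℓ →
    trans (sym (sumFin-distrib-+ lam _ _)) (sumFin-cong lam λ i → pointwise (p , ℓ , i))))

  countE-update : ∀ {f g : EKey → Bool} e {a b} → (∀ e′ → e′ ≢ e → f e′ ≡ g e′) →
    ind (f e) + a ≡ ind (g e) + b → countE f + a ≡ countE g + b
  countE-update (p , ℓ , i) off at =
    sumFin-update np p (λ p′ p′≢p → sumFin-cong nl λ ℓ′ → sumFin-cong lam λ i′ →
                          cong ind (off _ (p′≢p ∘ cong (λ (q , _ , _) → q))))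
      (sumFin-update nl ℓ (λ ℓ′ ℓ′≢ℓ → sumFin-cong lam λ i′ →
                             cong ind (off _ (ℓ′≢ℓ ∘ cong (λ (_ , m , _) → m))))
        (sumFin-update lam i (λ i′ i′≢i → cong ind (off _ (i′≢i ∘ cong (λ (_ , _ , j) → j)))) at))

  edgeCount-accept : ∀ h D e d → D e ≡ nothing →
    edgeCount h (setE e (just d) D) ≡ edgeCount h D + ind (h (src e d) (tgt e d))
  edgeCount-accept h D e d De≡nothing = trans (sym (+-identityʳ _)) (countE-update e off at)
    where
    off : ∀ e′ → e′ ≢ e → arcHolds h e′ (setE e (just d) D e′) ≡ arcHolds h e′ (D e′)
    off e′ e′≢e = cong (λ b → arcHolds h e′ (if b then just d else D e′)) (isYes-false (e′ ≟E e) e′≢e)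
    at : ind (arcHolds h e (setE e (just d) D e)) + 0 ≡ ind (arcHolds h e (D e)) + ind (h (src e d) (tgt e d))
    at rewrite isYes-true (e ≟E e) refl | De≡nothing = +-comm _ 0

  -- Reversing an arc x → y changes its h-count by [y ∈ V] − [x ∈ V]; along a path these
  -- differences telescope, and Move-Pebble's pebble transfer cancels the result.
  Balanced : (Vertex → Bool) → (Vertex → Vertex → Bool) → Set
  Balanced V h = ∀ x y → ind (h y x) + ind (V x) ≡ ind (h x y) + ind (V y)

  reverse-arc : ∀ {V h} → Balanced V h → ∀ e d →
    ind (h (src e (flipDir d)) (tgt e (flipDir d))) + ind (V (src e d))
      ≡ ind (h (src e d) (tgt e d)) + ind (V (tgt e d))
  reverse-arc balanced (p , ℓ , i) P→L = balanced (inj₁ p) (inj₂ ℓ)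
  reverse-arc balanced (p , ℓ , i) L→P = balanced (inj₂ ℓ) (inj₁ p)

  src∈path : ∀ {D u w vs es} → Path D u w vs es → ∀ {e d} → D e ≡ just d → memb e es ≡ true → src e d ∈ vs
  src∈path here _ ()
  src∈path (cons (arc e′ d′ De′≡d′) path) {e} De≡d e∈es with e ≟E e′
  ... | yes refl = here (cong (src e) (just-injective (trans (sym De≡d) De′≡d′)))
  ... | no _     = there (src∈path path De≡d e∈es)

  edgeCount-flipPath : ∀ {V h} → Balanced V h → ∀ {D v w vs es} → Path D v w vs es → Unique vs →
    edgeCount h (flipOn es D) + ind (V v) ≡ edgeCount h D + ind (V w)
  edgeCount-flipPath balanced here _ = refl
  edgeCount-flipPath {V} {h} balanced {D} {es = _ ∷ es} (cons (arc e d De≡d) path) (v∉path ∷ unique) =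
    trans (countE-update e off at) (edgeCount-flipPath {V} {h} balanced path unique)
    where
    -- a path repeats no vertex, so its first arc, which leaves the first vertex, is not used again
    e∉es : memb e es ≡ false
    e∉es = ¬-not (λ e∈es → lookup v∉path (src∈path path De≡d e∈es) refl)
    off : ∀ e′ → e′ ≢ e → arcHolds h e′ (flipOn (e ∷ es) D e′) ≡ arcHolds h e′ (flipOn es D e′)
    off e′ e′≢e = cong (λ b → arcHolds h e′ (if b ∨ memb e′ es then Maybe.map flipDir (D e′) else D e′))
                       (isYes-false (e′ ≟E e) e′≢e)
    at : ind (arcHolds h e (flipOn (e ∷ es) D e)) + ind (V (src e d))
           ≡ ind (arcHolds h e (flipOn es D e)) + ind (V (tgt e d))
    at rewrite isYes-true (e ≟E e) refl | e∉es | De≡d = reverse-arc {V} {h} balanced e d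

  potential : (Vertex → Bool) → (Vertex → Vertex → Bool) → State → ℕ
  potential V h s = pebV V s + edgeCount h (D s)

  potential-accept : ∀ V h {s} e d → D s e ≡ nothing → 0 < peb s (src e d) →
    potential V h (mkState (decr (src e d) (peb s)) (setE e (just d) (D s))) + ind (V (src e d))
      ≡ potential V h s + ind (h (src e d) (tgt e d))
  potential-accept V h {s} e d De≡nothing 0<peb = begin
    P′ + C′ + x  ≡⟨ xy∙z≈xz∙y P′ C′ x ⟩
    P′ + x + C′  ≡⟨ cong₂ _+_ (sumV-decr V (peb s) (src e d) 0<peb) (edgeCount-accept h (D s) e d De≡nothing) ⟩
    P + (C + y)  ≡⟨ +-assoc P C y ⟨
    P + C + y    ∎
    where
    open ≡-Reasoning
    P = pebV V s
    C = edgeCount h (D s)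
    P′ = sumV (restrict V (decr (src e d) (peb s)))
    C′ = edgeCount h (setE e (just d) (D s))
    x = ind (V (src e d))
    y = ind (h (src e d) (tgt e d))

  potential-move : ∀ {V h} → Balanced V h → ∀ {s v w vs es} → Path (D s) v w vs es → Unique vs →
    0 < peb s w → potential V h (mkState (incr v (decr w (peb s))) (flipOn es (D s))) ≡ potential V h s
  potential-move {V} {h} balanced {s} {v} {w} {vs} {es} path unique 0<peb = begin
    sumV (restrict V (incr v f′)) + C′  ≡⟨ cong (_+ C′) (sumV-incr V f′ v) ⟩
    P′ + ind (V v) + C′                 ≡⟨ xy∙z≈x∙zy P′ _ C′ ⟩
    P′ + (C′ + ind (V v))               ≡⟨ cong (P′ +_) (edgeCount-flipPath {V} {h} balanced path unique) ⟩
    P′ + (C + ind (V w))                ≡⟨ x∙yz≈xz∙y P′ C _ ⟩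
    P′ + ind (V w) + C                  ≡⟨ cong (_+ C) (sumV-decr V (peb s) w 0<peb) ⟩
    pebV V s + C                        ∎
    where
    open ≡-Reasoning
    f′ = decr w (peb s)
    P′ = sumV (restrict V f′)
    C = edgeCount h (D s)
    C′ = edgeCount h (flipOn es (D s))

  fromV leavingV insideV : (Vertex → Bool) → Vertex → Vertex → Bool
  fromV    V x y = V x
  leavingV V x y = V x ∧ not (V y)
  insideV  V x y = V x ∧ V y

  fromV-balanced : ∀ V → Balanced V (fromV V)
  fromV-balanced V x y = +-comm (ind (V y)) (ind (V x))

  leavingV-balanced : ∀ V → Balanced V (leavingV V)
  leavingV-balanced V x y = ind-leaving-swap (V x) (V y)

  potential-from≡weight : ∀ V {s} → Reachable s → potential V (fromV V) s ≡ weight V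
  potential-from≡weight V init = trans (cong (weight V +_) (countE-zero (λ _ → refl))) (+-identityʳ _)
  potential-from≡weight V (step {s} reach (accept-edge p ℓ i d _ De≡nothing _ 0<peb)) =
    trans (+-cancelʳ-≡ _ _ _ (potential-accept V (fromV V) {s} (p , ℓ , i) d De≡nothing 0<peb))
          (potential-from≡weight V reach)
  potential-from≡weight V (step {s} reach (move-pebble v w vs es path unique 0<peb)) =
    trans (potential-move {V} {fromV V} (fromV-balanced V) {s} path unique 0<peb) (potential-from≡weight V reach)

  endpoints≤pebV : ∀ V s {p ℓ i} d → V (src (p , ℓ , i) d) ≡ true → V (tgt (p , ℓ , i) d) ≡ true →
    peb s (inj₁ p) + peb s (inj₂ ℓ) ≤ pebV V s
  endpoints≤pebV V s P→L src∈V tgt∈V = pair≤sumV V (peb s) src∈V tgt∈V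
  endpoints≤pebV V s L→P src∈V tgt∈V = pair≤sumV V (peb s) tgt∈V src∈V

  -- Accepting an arc x → y lowers the potential only if both ends lie in V, and then the
  -- Accept-Edge condition had given V more than l pebbles.
  l≤-after-accept : ∀ x y {Φ Φ′ P P′} → Φ′ + ind x ≡ Φ + ind (x ∧ not y) → P′ + ind x ≡ P → P′ ≤ Φ′ →
    (x ≡ true → y ≡ true → l < P) → l ≤ Φ → l ≤ Φ′
  l≤-after-accept false y     Φ′≡Φ _ _ _ l≤Φ = ≤-trans l≤Φ (≤-reflexive (sym (+-cancelʳ-≡ 0 _ _ Φ′≡Φ)))
  l≤-after-accept true  false Φ′≡Φ _ _ _ l≤Φ = ≤-trans l≤Φ (≤-reflexive (sym (+-cancelʳ-≡ 1 _ _ Φ′≡Φ)))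
  l≤-after-accept true  true  _ P′+1≡P P′≤Φ′ l<P _ =
    ≤-trans (m<1+n⇒m≤n (subst (l <_) (trans (sym P′+1≡P) (+-comm _ 1)) (l<P refl refl))) P′≤Φ′

  l≤potential-leaving : l + lam ≤ k₁ + k₂ → ∀ V {p ℓ} → V (inj₁ p) ≡ true → V (inj₂ ℓ) ≡ true →
    ∀ {s} → Reachable s → l ≤ potential V (leavingV V) s
  l≤potential-leaving l+λ≤k₁+k₂ V p∈V ℓ∈V init =
    ≤-trans (≤-trans (m≤m+n l lam) l+λ≤k₁+k₂) (≤-trans (pair≤sumV V kτ p∈V ℓ∈V) (m≤m+n _ _))
  l≤potential-leaving l+λ≤k₁+k₂ V p∈V ℓ∈V (step {s} reach (accept-edge p ℓ i d _ De≡nothing l<peb 0<peb)) =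
    l≤-after-accept (V (src (p , ℓ , i) d)) (V (tgt (p , ℓ , i) d))
      (potential-accept V (leavingV V) {s} (p , ℓ , i) d De≡nothing 0<peb)
      (sumV-decr V (peb s) _ 0<peb) (m≤m+n _ _)
      (λ src∈V tgt∈V → <-≤-trans l<peb (endpoints≤pebV V s d src∈V tgt∈V))
      (l≤potential-leaving l+λ≤k₁+k₂ V p∈V ℓ∈V reach)
  l≤potential-leaving l+λ≤k₁+k₂ V p∈V ℓ∈V (step {s} reach (move-pebble v w vs es path unique 0<peb)) =
    ≤-trans (l≤potential-leaving l+λ≤k₁+k₂ V p∈V ℓ∈V reach)
            (≤-reflexive (sym (potential-move {V} {leavingV V} (leavingV-balanced V) {s} path unique 0<peb)))

  inside+leaving≡from : ∀ V D → edgeCount (insideV V) D + edgeCount (leavingV V) D ≡ edgeCount (fromV V) D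
  inside+leaving≡from V D = countE-+ (λ e → split e (D e))
    where
    split : ∀ e m → ind (arcHolds (insideV V) e m) + ind (arcHolds (leavingV V) e m) ≡ ind (arcHolds (fromV V) e m)
    split e nothing  = refl
    split e (just d) = ind-split (V (src e d)) (V (tgt e d))

  edgeCount-inside≡0 : ∀ V → (∀ p ℓ → V (inj₁ p) ∧ V (inj₂ ℓ) ≡ false) → ∀ D → edgeCount (insideV V) D ≡ 0
  edgeCount-inside≡0 V no-point-line D = countE-zero (λ e → none e (D e))
    where
    none : ∀ e m → arcHolds (insideV V) e m ≡ false
    none e           nothing    = refl
    none (p , ℓ , i) (just P→L) = no-point-line p ℓ
    none (p , ℓ , i) (just L→P) = trans (∧-comm (V (inj₂ ℓ)) _) (no-point-line p ℓ)

  single-point-line : ∀ v p ℓ → single v (inj₁ p) ∧ single v (inj₂ ℓ) ≡ false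
  single-point-line (inj₁ q) p ℓ = ∧-zeroʳ _
  single-point-line (inj₂ q) p ℓ = refl

  weight-union : ∀ A B → weight (union A B) ≡ k₁ * ∣ A ∣ + k₂ * ∣ B ∣
  weight-union A B = cong₂ _+_ (sumFin-member np A k₁) (sumFin-member nl B k₂)

lemma1 : (np nl lam k₁ k₂ l : ℕ) (I : Fin np → Fin nl → Bool) →
    l + lam ≤ k₁ + k₂ →
    (s : Game.State np nl lam k₁ k₂ l I) → Game.Reachable np nl lam k₁ k₂ l I s →
    ((v : Game.Vertex np nl lam k₁ k₂ l I) →
       Game.State.peb s v + Game.outV np nl lam k₁ k₂ l I (Game.single np nl lam k₁ k₂ l I v) s
         ≡ Game.kτ np nl lam k₁ k₂ l I v)
    × ((A : Subset np) (B : Subset nl) →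
       Game.pebV np nl lam k₁ k₂ l I (Game.union np nl lam k₁ k₂ l I A B) s
         + Game.spanV np nl lam k₁ k₂ l I (Game.union np nl lam k₁ k₂ l I A B) s
         + Game.outV np nl lam k₁ k₂ l I (Game.union np nl lam k₁ k₂ l I A B) s
         ≡ k₁ * ∣ A ∣ + k₂ * ∣ B ∣)
    × ((A : Subset np) (B : Subset nl) → Nonempty A → Nonempty B →
       l ≤ Game.pebV np nl lam k₁ k₂ l I (Game.union np nl lam k₁ k₂ l I A B) s
         + Game.outV np nl lam k₁ k₂ l I (Game.union np nl lam k₁ k₂ l I A B) s)
    × ((A : Subset np) (B : Subset nl) → Nonempty A → Nonempty B →
       Game.spanV np nl lam k₁ k₂ l I (Game.union np nl lam k₁ k₂ l I A B) s + l
         ≤ k₁ * ∣ A ∣ + k₂ * ∣ B ∣)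
lemma1 np nl lam k₁ k₂ l I l+λ≤k₁+k₂ s reach = vertex , subset , lower , upper
  where
  open Game np nl lam k₁ k₂ l I
  open GameInvariants np nl lam k₁ k₂ l I

  conservation : ∀ V → pebV V s + (spanV V s + outV V s) ≡ weight V
  conservation V = trans (cong (pebV V s +_) (inside+leaving≡from V (D s))) (potential-from≡weight V reach)

  vertex : ∀ v → peb s v + outV (single v) s ≡ kτ v
  vertex v = begin
    peb s v + outV (single v) s
      ≡⟨ cong₂ (λ a b → a + (b + outV (single v) s))
               (sumV-single (peb s) v) (edgeCount-inside≡0 (single v) (single-point-line v) (D s)) ⟨
    pebV (single v) s + (spanV (single v) s + outV (single v) s)  ≡⟨ conservation (single v) ⟩
    weight (single v)                                             ≡⟨ sumV-single kτ v ⟩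
    kτ v                                                          ∎
    where open ≡-Reasoning

  subset : ∀ A B → pebV (union A B) s + spanV (union A B) s + outV (union A B) s ≡ k₁ * ∣ A ∣ + k₂ * ∣ B ∣
  subset A B = trans (+-assoc (pebV (union A B) s) _ _) (trans (conservation (union A B)) (weight-union A B))

  lower : ∀ A B → Nonempty A → Nonempty B → l ≤ pebV (union A B) s + outV (union A B) s
  lower A B (p , p∈A) (ℓ , ℓ∈B) =
    l≤potential-leaving l+λ≤k₁+k₂ (union A B) (isYes-true (p ∈? A) p∈A) (isYes-true (ℓ ∈? B) ℓ∈B) reach

  upper : ∀ A B → Nonempty A → Nonempty B → spanV (union A B) s + l ≤ k₁ * ∣ A ∣ + k₂ * ∣ B ∣
  upper A B nonempty-A nonempty-B = begin
    spanV V s + l                     ≤⟨ +-monoʳ-≤ (spanV V s) (lower A B nonempty-A nonempty-B) ⟩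
    spanV V s + (pebV V s + outV V s) ≡⟨ x∙yz≈y∙xz (spanV V s) (pebV V s) (outV V s) ⟩
    pebV V s + (spanV V s + outV V s) ≡⟨ conservation V ⟩
    weight V                          ≡⟨ weight-union A B ⟩
    k₁ * ∣ A ∣ + k₂ * ∣ B ∣           ∎
    where
    open ≤-Reasoning
    V = union A B
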